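{- Let $G$ be a finite simple graph with vertices $v_1,\dots,v_n$ such that no vertex of $G$ is adjacent to all other vertices, and let $d$ be a positive integer. Let $G'$ be the graph with vertex set consisting of top vertices $t_1,\dots,t_d$, middle vertices $m_1,\dots,m_n$, and bottom vertices $b_{i,j}$ for $1\le i\le n$, $1\le j\le n+1$, whose edges are: all pairs of distinct top vertices; all pairs of distinct bottom vertices; all pairs $t_i m_j$; and $m_i b_{j,k}$ exactly when $i=j$ or $v_iv_j$ is an edge of $G$; there are no other edges. Let $h=n(n+1)+d$. Then $G$ has domatic number at least $d$ if and only if $G'$ has Hadwiger number at least $h$.
   Context: A vertex $v$ dominates $w$ if $v=w$ or $vw$ is an edge; a dominating set of $G$ is a vertex set $D$ such that every vertex is dominated by some member of $D$. The domatic number of $G$ is the maximum number of pairwise disjoint dominating sets of $G$. The Hadwiger number of a graph is the largest $h$ such that $K_h$ is a minor of it, equivalently the largest number of pairwise disjoint connected vertex subsets that are pairwise joined by edges. -}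

module Defs where

open import Level using (0ℓ)
open import Data.Nat using (ℕ; suc; _+_; _*_)
open import Data.Fin using (Fin)
open import Data.Product using (Σ; ∃; _×_; _,_)
open import Data.Sum using (_⊎_; inj₁; inj₂)
open import Data.Empty using (⊥)
open import Data.Unit using (⊤)
open import Relation.Nullary using (¬_; Dec)
open import Relation.Binary.PropositionalEquality using (_≡_)

record Graph (V : Set) : Set₁ where
  field
    Adj     : V → V → Set
    sym     : ∀ {x y} → Adj x y → Adj y x
    irrefl  : ∀ {x} → ¬ Adj x x
    adj?    : ∀ x y → Dec (Adj x y)
open Graph public

Dominates : ∀ {V} → Graph V → V → V → Set
Dominates G v w = (v ≡ w) ⊎ Adj G v w

IsDominating : ∀ {V} → Graph V → (V → Set) → Set
IsDominating {V} G D = ∀ (w : V) → ∃ λ v → D v × Dominates G v w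

PairwiseDisjoint : ∀ {V} {k : ℕ} → (Fin k → V → Set) → Set
PairwiseDisjoint {V} {k} S = ∀ (i j : Fin k) → ¬ (i ≡ j) → ∀ (v : V) → S i v → S j v → ⊥

DomaticAtLeast : ∀ {V} → Graph V → ℕ → Set₁
DomaticAtLeast {V} G d =
  Σ (Fin d → V → Set) λ D → PairwiseDisjoint D × (∀ i → IsDominating G (D i))

data WalkIn {V} (G : Graph V) (S : V → Set) : V → V → Set where
  here : ∀ {x} → S x → WalkIn G S x x
  step : ∀ {x y z} → S x → Adj G x y → WalkIn G S y z → WalkIn G S x z

Connected : ∀ {V} → Graph V → (V → Set) → Set
Connected {V} G S = (∃ λ v → S v) × (∀ x y → S x → S y → WalkIn G S x y)

HadwigerAtLeast : ∀ {V} → Graph V → ℕ → Set₁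
HadwigerAtLeast {V} G h =
  Σ (Fin h → V → Set) λ B →
    PairwiseDisjoint B
    × (∀ i → Connected G (B i))
    × (∀ (i j : Fin h) → ¬ (i ≡ j) → ∃ λ x → ∃ λ y → B i x × B j y × Adj G x y)

NoDominatingVertex : ∀ {n} → Graph (Fin n) → Set
NoDominatingVertex {n} G = ∀ (v : Fin n) → ∃ λ w → ¬ (v ≡ w) × ¬ Adj G v w

-- vertex set of G': top t_i (i < d), middle m_i (i < n), bottom b_{i,j} (i < n, j < n+1)
V′ : ℕ → ℕ → Set
V′ n d = Fin d ⊎ (Fin n ⊎ (Fin n × Fin (suc n)))

Adj′ : ∀ {n d} → Graph (Fin n) → V′ n d → V′ n d → Set
Adj′ G (inj₁ s) (inj₁ t) = ¬ (s ≡ t)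
Adj′ G (inj₁ _) (inj₂ (inj₁ _)) = ⊤
Adj′ G (inj₁ _) (inj₂ (inj₂ _)) = ⊥
Adj′ G (inj₂ (inj₁ _)) (inj₁ _) = ⊤
Adj′ G (inj₂ (inj₁ _)) (inj₂ (inj₁ _)) = ⊥
Adj′ G (inj₂ (inj₁ i)) (inj₂ (inj₂ (j , _))) = Dominates G i j
Adj′ G (inj₂ (inj₂ _)) (inj₁ _) = ⊥
Adj′ G (inj₂ (inj₂ (j , _))) (inj₂ (inj₁ i)) = Dominates G i j
Adj′ G (inj₂ (inj₂ p)) (inj₂ (inj₂ q)) = ¬ (p ≡ q)

open import Relation.Nullary using (yes; no)
open import Relation.Nullary.Negation using (contradiction)
open import Relation.Binary.PropositionalEquality using (refl) renaming (sym to ≡-sym)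
open import Data.Sum.Properties using (≡-dec)
open import Data.Product.Properties using () renaming (≡-dec to ×-≡-dec)
import Data.Fin as F

private
  _≟V_ : ∀ {n d} (x y : V′ n d) → Dec (x ≡ y)
  _≟V_ = ≡-dec F._≟_ (≡-dec F._≟_ (×-≡-dec F._≟_ F._≟_))

  dom? : ∀ {n} (G : Graph (Fin n)) i j → Dec (Dominates G i j)
  dom? G i j with i F.≟ j | adj? G i j
  ... | yes p | _ = yes (inj₁ p)
  ... | no _ | yes q = yes (inj₂ q)
  ... | no p | no q = no λ { (inj₁ r) → p r ; (inj₂ r) → q r }

  neg? : ∀ {A : Set} → Dec A → Dec (¬ A)
  neg? (yes a) = no λ f → f a
  neg? (no a) = yes a

  sym′ : ∀ {n d} (G : Graph (Fin n)) {x y : V′ n d} → Adj′ G x y → Adj′ G y x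
  sym′ G {inj₁ s} {inj₁ t} p e = p (≡-sym e)
  sym′ G {inj₁ _} {inj₂ (inj₁ _)} p = p
  sym′ G {inj₂ (inj₁ _)} {inj₁ _} p = p
  sym′ G {inj₂ (inj₁ _)} {inj₂ (inj₂ _)} p = p
  sym′ G {inj₂ (inj₂ _)} {inj₂ (inj₁ _)} p = p
  sym′ G {inj₂ (inj₂ _)} {inj₂ (inj₂ _)} p e = p (≡-sym e)

  irrefl′ : ∀ {n d} (G : Graph (Fin n)) {x : V′ n d} → ¬ Adj′ G x x
  irrefl′ G {inj₁ _} p = p refl
  irrefl′ G {inj₂ (inj₁ _)} ()
  irrefl′ G {inj₂ (inj₂ _)} p = p refl

  adj′? : ∀ {n d} (G : Graph (Fin n)) (x y : V′ n d) → Dec (Adj′ G x y)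
  adj′? G (inj₁ s) (inj₁ t) = neg? (s F.≟ t)
  adj′? G (inj₁ _) (inj₂ (inj₁ _)) = yes _
  adj′? G (inj₁ _) (inj₂ (inj₂ _)) = no λ ()
  adj′? G (inj₂ (inj₁ _)) (inj₁ _) = yes _
  adj′? G (inj₂ (inj₁ _)) (inj₂ (inj₁ _)) = no λ ()
  adj′? G (inj₂ (inj₁ i)) (inj₂ (inj₂ (j , _))) = dom? G i j
  adj′? G (inj₂ (inj₂ _)) (inj₁ _) = no λ ()
  adj′? G (inj₂ (inj₂ (j , _))) (inj₂ (inj₁ i)) = dom? G i j
  adj′? G (inj₂ (inj₂ p)) (inj₂ (inj₂ q)) = neg? (×-≡-dec F._≟_ F._≟_ p q)

G′ : ∀ {n} → Graph (Fin n) → (d : ℕ) → Graph (V′ n d)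
G′ G d = record { Adj = Adj′ G ; sym = sym′ G ; irrefl = irrefl′ G ; adj? = adj′? G }

module Submission where

-- Call the tops t_k and bottoms b_{u,l} of G′ its *outer* vertices; there are
-- exactly h = n(n+1) + d of them, and the middle vertices form an independent
-- set whose neighbours are all outer.
--
-- (⇒) From disjoint dominating sets D_1..D_d take the branch sets
-- {t_k} ∪ {m_v : v ∈ D_k} (a star around t_k) and the singletons {b_{u,l}};
-- b_{u,l} touches the k-th star because D_k dominates u.
--
-- (⇐) Given h disjoint, connected, pairwise touching branch sets:
--  * every branch set contains an outer vertex: a branch set inside the middle
--    layer would, by counting, need more outer neighbours of one m_v than
--    exist, as m_v misses all n+1 copies of a vertex u it does not dominate;
--  * h disjoint sets meeting an h-element set each contain exactly one of its
--    elements, so every outer vertex has a unique branch set;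
--  * D_k = middle vertices of the branch set of t_k; it dominates u, since
--    otherwise the n+1 branch sets of b_{u,1},..,b_{u,n+1} would each need
--    their own middle vertex to touch it (pigeonhole).

open import Defs hiding (sym)
open import Data.Nat using (ℕ; suc; _+_; _*_; _≤_; _<_)
open import Data.Nat.Properties using (n<1+n)
open import Data.Fin using (Fin; zero; suc; _≟_; punchOut)
open import Data.Fin.Properties
  using (any?; punchOut-injective; <⇒notInjective; sequence; +↔⊎; *↔×)
open import Data.Product using (∃; _×_; _,_; proj₁; proj₂; map₂)
open import Data.Sum using (_⊎_; inj₁; inj₂; [_,_])
open import Data.Sum.Algebra using (⊎-comm; ⊎-cong)
open import Data.Sum.Properties using (inj₁-injective; inj₂-injective)
import Data.Sum.Effectful.Left as SumLeft
open import Data.Empty using (⊥; ⊥-elim)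
open import Data.Unit using (tt)
open import Function using (_∘_; Injective; _↔_; _⇔_; mk⇔; Injection)
open import Function.Properties.Inverse using (↔-refl; ↔-sym; ↔-trans; Inverse⇒Injection)
open import Relation.Nullary using (¬_; yes; no)
open import Relation.Binary.PropositionalEquality
  using (_≡_; refl; sym; trans; cong; subst)

-- An injective self-map of Fin m is onto: a missed point would let us
-- squeeze Fin m injectively into Fin (m - 1).
injective⇒surjective : ∀ {m} (f : Fin m → Fin m) → Injective _≡_ _≡_ f →
                       ∀ z → ∃ λ j → f j ≡ z
injective⇒surjective {suc m} f f-injective z with any? (λ j → f j ≟ z)
... | yes hit = hit
... | no miss = ⊥-elim (<⇒notInjective {f = squeeze} (n<1+n m) squeeze-injective)
  where
  squeeze : Fin (suc m) → Fin m
  squeeze j = punchOut {i = z} (λ e → miss (j , sym e))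

  squeeze-injective : Injective _≡_ _≡_ squeeze
  squeeze-injective {i} {j} =
    f-injective ∘ punchOut-injective {i = z} (λ e → miss (i , sym e)) (λ e → miss (j , sym e))

someOrAll : ∀ {A : Set} {m} {P : Fin m → Set} → (∀ j → A ⊎ P j) → A ⊎ (∀ j → P j)
someOrAll {A} = sequence (SumLeft.applicative A _)

module Disjoint {A : Set} {m : ℕ} (C : Fin m → A → Set) (disjoint : PairwiseDisjoint C) where

  same-member : ∀ {i j a} → C i a → C j a → i ≡ j
  same-member {i} {j} {a} a∈Ci a∈Cj with i ≟ j
  ... | yes i≡j = i≡j
  ... | no i≢j = ⊥-elim (disjoint i j i≢j a a∈Ci a∈Cj)

  choice-injective : (c : ∀ j → ∃ (C j)) → Injective _≡_ _≡_ (proj₁ ∘ c)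
  choice-injective c {i} {j} e = same-member (proj₂ (c i)) (subst (C j) (sym e) (proj₂ (c j)))

  every-element-chosen : A ↔ Fin m → (c : ∀ j → ∃ (C j)) → ∀ a → ∃ λ j → proj₁ (c j) ≡ a
  every-element-chosen A↔Fin c a =
    map₂ injective (injective⇒surjective (to ∘ proj₁ ∘ c) (choice-injective c ∘ injective) (to a))
    where open Injection (Inverse⇒Injection A↔Fin) using (to; injective)

  covering : A ↔ Fin m → (∀ j → ∃ (C j)) → ∀ a → ∃ λ j → C j a
  covering A↔Fin c a with j , refl ← every-element-chosen A↔Fin c a = j , proj₂ (c j)

disjoint-pigeonhole : ∀ {k m} → k < m → (C : Fin m → Fin k → Set) → PairwiseDisjoint C →
                      ¬ (∀ j → ∃ (C j))
disjoint-pigeonhole k<m C disjoint c =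
  <⇒notInjective k<m (Disjoint.choice-injective C disjoint c)

walk-start : ∀ {V} {G : Graph V} {S : V → Set} {x y} → WalkIn G S x y → S x
walk-start (here x∈S) = x∈S
walk-start (step x∈S _ _) = x∈S

_++ʷ_ : ∀ {V} {G : Graph V} {S : V → Set} {x y z} →
        WalkIn G S x y → WalkIn G S y z → WalkIn G S x z
here _ ++ʷ w′ = w′
step x∈S x~y w ++ʷ w′ = step x∈S x~y (w ++ʷ w′)

star-connected : ∀ {V} (G : Graph V) (S : V → Set) (c : V) → S c →
                 (∀ x → S x → x ≡ c ⊎ Adj G x c) → Connected G S
star-connected G S c c∈S spoke = (c , c∈S) , λ x y x∈S y∈S → inward x x∈S ++ʷ outward y y∈S
  where
  inward : ∀ x → S x → WalkIn G S x c
  inward x x∈S with spoke x x∈S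
  ... | inj₁ refl = here x∈S
  ... | inj₂ x~c = step x∈S x~c (here c∈S)

  outward : ∀ y → S y → WalkIn G S c y
  outward y y∈S with spoke y y∈S
  ... | inj₁ refl = here y∈S
  ... | inj₂ y~c = step c∈S (Graph.sym G y~c) (here y∈S)

hadwiger-from-model : ∀ {V I : Set} {h} (G : Graph V) → I ↔ Fin h → (B : I → V → Set) →
  (∀ a b → ¬ a ≡ b → ∀ x → B a x → B b x → ⊥) →
  (∀ a → Connected G (B a)) →
  (∀ a b → ¬ a ≡ b → ∃ λ x → ∃ λ y → B a x × B b y × Adj G x y) →
  HadwigerAtLeast G h
hadwiger-from-model G I↔Fin B disjoint connected touching =
    B ∘ index
  , (λ i j i≢j → disjoint (index i) (index j) (i≢j ∘ index-injective))
  , connected ∘ index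
  , (λ i j i≢j → touching (index i) (index j) (i≢j ∘ index-injective))
  where
  open Injection (Inverse⇒Injection (↔-sym I↔Fin))
    using () renaming (to to index; injective to index-injective)

pattern top k = inj₁ k
pattern mid v = inj₂ (inj₁ v)
pattern bot p = inj₂ (inj₂ p)

Outer : ℕ → ℕ → Set
Outer n d = Fin d ⊎ (Fin n × Fin (suc n))

outer : ∀ {n d} → Outer n d → V′ n d
outer (inj₁ k) = top k
outer (inj₂ p) = bot p

Outer↔Fin : ∀ {n d} → Outer n d ↔ Fin (n * suc n + d)
Outer↔Fin {n} {d} =
  ↔-trans (⊎-comm _ _) (↔-trans (⊎-cong (↔-sym (*↔× {n} {suc n})) ↔-refl) (↔-sym (+↔⊎ {n * suc n} {d})))

Near : ∀ {n d} → Graph (Fin n) → Fin n → Outer n d → Set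
Near {d = d} G v z = Adj′ {d = d} G (mid v) (outer z)

module _ {n d : ℕ} (G : Graph (Fin n)) where

  middle-neighbour : ∀ {P : V′ n d → Set} {v y} → Adj′ G (mid v) y → P y →
                     ∃ λ z → P (outer z) × Near G v z
  middle-neighbour {y = top k} v~y y∈P = inj₁ k , y∈P , v~y
  middle-neighbour {y = bot p} v~y y∈P = inj₂ p , y∈P , v~y

  exit-from-middle : ∀ {S v x y} → WalkIn (G′ G d) S (mid v) x → Adj′ G x y →
                     ∃ (S ∘ outer) ⊎ Adj′ G (mid v) y
  exit-from-middle (here _) x~y = inj₂ x~y
  exit-from-middle (step _ v~w w) _ with z , z∈S , _ ← middle-neighbour v~w (walk-start w) =
    inj₁ (z , z∈S)

module Forward {n d} (G : Graph (Fin n)) (D : Fin d → Fin n → Set)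
  (D-disjoint : PairwiseDisjoint D) (D-dominating : ∀ k → IsDominating G (D k)) where

  Branch : Outer n d → V′ n d → Set
  Branch (inj₁ k) (top k′) = k′ ≡ k
  Branch (inj₁ k) (mid v) = D k v
  Branch (inj₂ p) (bot q) = q ≡ p
  Branch _ _ = ⊥

  branch-disjoint : ∀ a b → ¬ a ≡ b → ∀ x → Branch a x → Branch b x → ⊥
  branch-disjoint (inj₁ k) (inj₁ k′) k≢k′ (top _) refl refl = k≢k′ refl
  branch-disjoint (inj₁ k) (inj₁ k′) k≢k′ (mid v) v∈Dk v∈Dk′ =
    D-disjoint k k′ (k≢k′ ∘ cong inj₁) v v∈Dk v∈Dk′
  branch-disjoint (inj₂ p) (inj₂ q) p≢q (bot _) refl refl = p≢q refl
  branch-disjoint (inj₁ _) (inj₂ _) _ (bot _) () _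
  branch-disjoint (inj₂ _) (inj₁ _) _ (bot _) _ ()

  branch-connected : ∀ a → Connected (G′ G d) (Branch a)
  branch-connected a = star-connected (G′ G d) (Branch a) (outer a) (centre a) (spoke a)
    where
    centre : ∀ a → Branch a (outer a)
    centre (inj₁ _) = refl
    centre (inj₂ _) = refl

    spoke : ∀ a x → Branch a x → x ≡ outer a ⊎ Adj′ G x (outer a)
    spoke (inj₁ _) (top _) refl = inj₁ refl
    spoke (inj₁ _) (mid _) _ = inj₂ tt
    spoke (inj₂ _) (bot _) refl = inj₁ refl

  -- b_{u,l} touches the star of t_k through a vertex of D_k dominating u.
  branch-touching : ∀ a b → ¬ a ≡ b → ∃ λ x → ∃ λ y → Branch a x × Branch b y × Adj′ G x y
  branch-touching (inj₁ k) (inj₁ k′) k≢k′ = top k , top k′ , refl , refl , k≢k′ ∘ cong inj₁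
  branch-touching (inj₂ p) (inj₂ q) p≢q = bot p , bot q , refl , refl , p≢q ∘ cong inj₂
  branch-touching (inj₁ k) (inj₂ (u , l)) _ with v , v∈Dk , v⇒u ← D-dominating k u =
    mid v , bot (u , l) , v∈Dk , refl , v⇒u
  branch-touching (inj₂ (u , l)) (inj₁ k) _ with v , v∈Dk , v⇒u ← D-dominating k u =
    bot (u , l) , mid v , refl , v∈Dk , v⇒u

  hadwiger : HadwigerAtLeast (G′ G d) (n * suc n + d)
  hadwiger = hadwiger-from-model (G′ G d) Outer↔Fin Branch
               branch-disjoint branch-connected branch-touching

module Backward {n d} (G : Graph (Fin n)) (no-dominating : NoDominatingVertex G)
  (B : Fin (n * suc n + d) → V′ n d → Set) (disjoint : PairwiseDisjoint B)
  (connected : ∀ i → Connected (G′ G d) (B i))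
  (touching : ∀ i j → ¬ i ≡ j → ∃ λ x → ∃ λ y → B i x × B j y × Adj (G′ G d) x y) where

  h : ℕ
  h = n * suc n + d

  open Disjoint B disjoint using (same-member)

  -- Outer vertices seen from m_v ∈ B_i in branch set j: a neighbour of m_v
  -- in B_j for j ≠ i, and the copy b_{u,0} of a non-dominated u for j = i.
  Seen : Fin h → Fin n → Fin n → Fin h → Outer n d → Set
  Seen i v u j z = (i ≡ j × z ≡ inj₂ (u , zero)) ⊎ (¬ i ≡ j × B j (outer z) × Near G v z)

  seen-disjoint : ∀ {i v u} → ¬ Dominates G v u → PairwiseDisjoint (Seen i v u)
  seen-disjoint _ _ _ j≢j′ _ (inj₁ (refl , _)) (inj₁ (refl , _)) = j≢j′ refl
  seen-disjoint v↛u _ _ _ _ (inj₁ (_ , refl)) (inj₂ (_ , _ , v⇒u)) = v↛u v⇒u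
  seen-disjoint v↛u _ _ _ _ (inj₂ (_ , _ , v⇒u)) (inj₁ (_ , refl)) = v↛u v⇒u
  seen-disjoint _ j j′ j≢j′ z (inj₂ (_ , z∈Bj , _)) (inj₂ (_ , z∈Bj′ , _)) =
    disjoint j j′ j≢j′ (outer z) z∈Bj z∈Bj′

  -- Either every branch set is seen from m_v ∈ B_i, or B_i has an outer vertex:
  -- an edge from B_i to B_j starts at m_v or the walk to it leaves the middle.
  sees : ∀ {i v} u → B i (mid v) → ∀ j → ∃ (B i ∘ outer) ⊎ ∃ (Seen i v u j)
  sees {i} u _ j with i ≟ j
  sees {i} u _ j | yes i≡j = inj₂ (inj₂ (u , zero) , inj₁ (i≡j , refl))
  sees {i} {v} u v∈Bi j | no i≢j
    with x , y , x∈Bi , y∈Bj , x~y ← touching i j i≢j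
    with exit-from-middle G (proj₂ (connected i) (mid v) x v∈Bi x∈Bi) x~y
  ... | inj₁ outer∈Bi = inj₁ outer∈Bi
  ... | inj₂ v~y with z , z∈Bj , v~z ← middle-neighbour G v~y y∈Bj =
    inj₂ (z , inj₂ (i≢j , z∈Bj , v~z))

  -- Otherwise, with m_v ∈ B_i and
  -- u not dominated by v, the h disjoint sets Seen i v u would all be
  -- inhabited, so every outer vertex would be seen — but b_{u,v+1} is not.
  outer-member : ∀ i → ∃ (B i ∘ outer)
  outer-member i with proj₁ (connected i)
  ... | top k , k∈Bi = inj₁ k , k∈Bi
  ... | bot p , p∈Bi = inj₂ p , p∈Bi
  ... | mid v , v∈Bi with u , v≢u , v≁u ← no-dominating v with someOrAll (sees u v∈Bi)
  ...   | inj₁ found = found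
  ...   | inj₂ seen =
    ⊥-elim (unseen (proj₂ (Disjoint.covering (Seen i v u) (seen-disjoint v↛u) Outer↔Fin seen missed)))
    where
    v↛u : ¬ Dominates G v u
    v↛u = [ v≢u , v≁u ]

    missed : Outer n d
    missed = inj₂ (u , suc v)

    unseen : ∀ {j} → ¬ Seen i v u j missed
    unseen (inj₁ (_ , ()))
    unseen (inj₂ (_ , _ , v⇒u)) = v↛u v⇒u

  -- A chosen outer vertex of B_i (shown below to be its only one).
  rep : Fin h → Outer n d
  rep i = proj₁ (outer-member i)

  owned : ∀ z → ∃ λ j → rep j ≡ z
  owned = Disjoint.every-element-chosen (λ j → B j ∘ outer)
            (λ j j′ j≢j′ → disjoint j j′ j≢j′ ∘ outer) Outer↔Fin outer-member

  owner : Outer n d → Fin h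
  owner z = proj₁ (owned z)

  rep-owner : ∀ z → rep (owner z) ≡ z
  rep-owner z = proj₂ (owned z)

  owner-injective : ∀ {z z′} → owner z ≡ owner z′ → z ≡ z′
  owner-injective {z} {z′} e = trans (sym (rep-owner z)) (trans (cong rep e) (rep-owner z′))

  owner-member : ∀ z → B (owner z) (outer z)
  owner-member z = subst (B (owner z) ∘ outer) (rep-owner z) (proj₂ (outer-member (owner z)))

  owned-only : ∀ {z z′} → B (owner z) (outer z′) → z′ ≡ z
  owned-only {z} {z′} z′∈B = owner-injective (same-member (owner-member z′) z′∈B)

  -- D_k: the middle vertices of the branch set owning t_k; disjoint since
  -- t_k and t_k′ lie in different branch sets.
  D : Fin d → Fin n → Set
  D k v = B (owner (inj₁ k)) (mid v)

  D-disjoint : PairwiseDisjoint D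
  D-disjoint k k′ k≢k′ v v∈Dk v∈Dk′ =
    k≢k′ (inj₁-injective (owner-injective (same-member v∈Dk v∈Dk′)))

  bottom-edge : ∀ k u l → (∃ λ v → D k v × Dominates G v u)
                          ⊎ (∃ λ c → B (owner (inj₂ (u , l))) (mid c))
  bottom-edge k u l = classify (touching (owner (inj₁ k)) (owner (inj₂ (u , l))) top≢bot)
    where
    top≢bot : ¬ owner (inj₁ k) ≡ owner (inj₂ (u , l))
    top≢bot e with () ← owner-injective {inj₁ k} {inj₂ (u , l)} e

    classify : (∃ λ x → ∃ λ y → B (owner (inj₁ k)) x × B (owner (inj₂ (u , l))) y × Adj′ G x y) →
               (∃ λ v → D k v × Dominates G v u) ⊎ (∃ λ c → B (owner (inj₂ (u , l))) (mid c))
    classify (top _ , mid c , _ , c∈B , _) = inj₂ (c , c∈B)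
    classify (mid v , bot p , v∈Dk , p∈B , v~p)
      with refl ← owned-only {inj₂ (u , l)} {inj₂ p} p∈B = inj₁ (v , v∈Dk , v~p)
    classify (top _ , bot _ , _ , _ , ())
    classify (mid _ , mid _ , _ , _ , ())
    classify (_ , top t , _ , t∈B , _) with () ← owned-only {inj₂ (u , l)} {inj₁ t} t∈B
    classify (bot p , _ , p∈B , _ , _) with () ← owned-only {inj₁ k} {inj₂ p} p∈B

  -- If D_k missed u, the n+1 disjoint branch sets of b_{u,l} would each
  -- contain one of only n middle vertices.
  D-dominating : ∀ k → IsDominating G (D k)
  D-dominating k u with someOrAll (bottom-edge k u)
  ... | inj₁ found = found
  ... | inj₂ middles = ⊥-elim (disjoint-pigeonhole (n<1+n n) Middle middle-disjoint middles)
    where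
    Middle : Fin (suc n) → Fin n → Set
    Middle l c = B (owner (inj₂ (u , l))) (mid c)

    middle-disjoint : PairwiseDisjoint Middle
    middle-disjoint l l′ l≢l′ c =
      disjoint _ _ (l≢l′ ∘ cong proj₂ ∘ inj₂-injective ∘ owner-injective) (mid c)

  domatic : DomaticAtLeast G d
  domatic = D , D-disjoint , D-dominating

-- The theorem.
lemma6 : ∀ (n d : ℕ) (G : Graph (Fin n)) → NoDominatingVertex G → 1 ≤ d →
    (DomaticAtLeast G d ⇔ HadwigerAtLeast (G′ G d) (n * suc n + d))
lemma6 n d G no-dominating _ = mk⇔
  (λ (D , D-disjoint , D-dominating) → Forward.hadwiger G D D-disjoint D-dominating)
  (λ (B , disjoint , connected , touching) →
     Backward.domatic G no-dominating B disjoint connected touching)
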